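{- Given a composition $\overline{w}$ with at least two components. Let $\lambda=\lceil\frac{w}{w_1}\rceil$ and $s=\lambda w_1-w$. Then \[N_{ccc}(\overline{w})\geq \mu w_1+ \lceil \frac{\mu}{\lambda(\lambda-1)}\rceil= (\mu+1) w_1-\left\lfloor\frac{2s}{\lambda}\right\rfloor,\] where $\mu=\lambda(\lambda-1)w_1-2(\lambda-1)s$.
   Context: A $q$-ary code of length $n$ is a subset of $\mathbb{Z}_q^n$ with Hamming distance. The composition of a vector $u$ is the tuple $\overline{w}=(w_1,\ldots,w_{q-1})$ where $w_i$ is the number of coordinates of $u$ equal to $i$; compositions are written with positive components in non-increasing order $w_1\geq\cdots\geq w_{q-1}\geq 1$, and $w=\sum_i w_i$. $A_q(n,d,\overline{w})$ is the maximum size of a $q$-ary code of length $n$, minimum distance $d$, constant composition $\overline{w}$. $N_{ccc}(\overline{w})=\min\{n_0: A_q(n,2w-1,\overline{w})=\lfloor n/w_1\rfloor \text{ for all } n\geq n_0\}$. -}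

module Defs where

open import Data.Nat using (ℕ; zero; suc; _+_; _*_; _∸_; _≤_; _≥_)
open import Data.Nat.DivMod using (_/_)
open import Data.Fin using (Fin; _≟_) renaming (zero to fzero; suc to fsuc)
open import Data.Vec using (Vec; []; _∷_; lookup; head; sum)
open import Data.Unit using (⊤)
open import Data.List using (List; length)
open import Data.List.Relation.Unary.All using (All)
open import Data.List.Relation.Unary.AllPairs using (AllPairs)
open import Data.Product using (_×_; Σ)
open import Relation.Binary.PropositionalEquality using (_≡_; _≢_)
open import Relation.Nullary using (yes; no)

Word : ℕ → ℕ → Set
Word q n = Vec (Fin q) n

hamming : ∀ {q n} → Word q n → Word q n → ℕ
hamming [] [] = 0
hamming (x ∷ u) (y ∷ v) with x ≟ y
... | yes _ = hamming u v
... | no _ = suc (hamming u v)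

count : ∀ {q n} → Fin q → Word q n → ℕ
count a [] = 0
count a (x ∷ u) with a ≟ x
... | yes _ = suc (count a u)
... | no _ = count a u

NonIncreasing : ∀ {k} → Vec ℕ k → Set
NonIncreasing [] = ⊤
NonIncreasing (x ∷ []) = ⊤
NonIncreasing (x ∷ y ∷ xs) = (y ≤ x) × NonIncreasing (y ∷ xs)

Positive : ∀ {k} → Vec ℕ k → Set
Positive [] = ⊤
Positive (x ∷ xs) = (1 ≤ x) × Positive xs

IsComposition : ∀ {k} → Vec ℕ k → Set
IsComposition w = Positive w × NonIncreasing w

-- For a composition with k components the alphabet is Z_q with q = k + 1.
-- u has composition w̄: symbol i (1 ≤ i ≤ k) occurs exactly w_i times.
HasComposition : ∀ {k n} → Vec ℕ k → Word (suc k) n → Set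
HasComposition {k} w u = (i : Fin k) → count (fsuc i) u ≡ lookup w i

IsCode : ∀ {q n} → ℕ → List (Word q n) → Set
IsCode d C = AllPairs (λ x y → (x ≢ y) × (d ≤ hamming x y)) C

IsCCC : ∀ {k} → (n d : ℕ) → Vec ℕ k → List (Word (suc k) n) → Set
IsCCC n d w C = IsCode d C × All (HasComposition w) C

AEq : ∀ {k} → (n d : ℕ) → Vec ℕ k → ℕ → Set
AEq {k} n d w m =
  Σ (List (Word (suc k) n)) (λ C → IsCCC n d w C × length C ≡ m)
  × ((C : List (Word (suc k) n)) → IsCCC n d w C → length C ≤ m)

-- Total floor / ceiling division (value 0 when dividing by 0; never used that way).
fdiv : ℕ → ℕ → ℕ
fdiv a zero = 0
fdiv a (suc b) = a / suc b

cdiv : ℕ → ℕ → ℕ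
cdiv a zero = 0
cdiv a (suc b) = (a + b) / suc b

-- n₀ is admissible in the definition of N_ccc(w̄):
-- A_q(n, 2w-1, w̄) = ⌊n / w₁⌋ for all n ≥ n₀.
NcccAdmissible : ∀ {k} → Vec ℕ (suc k) → ℕ → Set
NcccAdmissible w n₀ =
  (n : ℕ) → n₀ ≤ n → AEq n (2 * sum w ∸ 1) w (fdiv n (head w))

-- N_ccc(w̄) ≥ b : every admissible n₀ (hence the minimum one) is ≥ b.
NcccAtLeast : ∀ {k} → Vec ℕ (suc k) → ℕ → Set
NcccAtLeast w b = (n₀ : ℕ) → NcccAdmissible w n₀ → b ≤ n₀

lam : ∀ {k} → Vec ℕ (suc k) → ℕ
lam w = cdiv (sum w) (head w)

sPar : ∀ {k} → Vec ℕ (suc k) → ℕ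
sPar w = lam w * head w ∸ sum w

mu : ∀ {k} → Vec ℕ (suc k) → ℕ
mu w = lam w * (lam w ∸ 1) * head w ∸ 2 * (lam w ∸ 1) * sPar w

module Submission where

-- Write h = w₁, W = w, λ, s, μ as in the statement and a = λ - 1.  Every
-- word of composition w̄ has Hamming weight W, and two such words at distance
-- at least 2W - 1 share at most one nonzero coordinate.  Counting, column by
-- column, the pairs of codewords with a common nonzero coordinate, and using
-- (R - a)(R - a - 1) ≥ 0 for the number R of nonzero entries of a column,
-- gives for every such code C of length n the Johnson-type bound
--     2a·|C|·W + |C| ≤ |C|² + n·a(a+1).                    (code-size-bound)
-- Writing λ = 2 + l, s = f + g, h = 1 + s + r and 2s = fλ + e with e < λ
-- (record ParameterSplit; then f = ⌊2s/λ⌋), every quantity of the statement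
-- becomes a polynomial in l, f, g, r.  The claimed bound equals N + 1 with
-- N = μh + g + r, both of its expressions agree, and ⌊N/h⌋ = μ.  If some
-- n₀ ≤ N were admissible, A_q(N, 2W-1, w̄) = μ would provide a code of size μ
-- at length N, which violates the code-size bound (size-bound-violated).

open import Defs
open import Data.Nat using (ℕ; zero; suc; _+_; _*_; _∸_; _≤_; _<_; s≤s; z≤n; _≤?_)
open import Data.Nat.Properties hiding (_≟_)
open import Data.Nat.DivMod using (_/_; _%_; m≡m%n+[m/n]*n; m%n<n; m<n⇒m/n≡0; m*n/n≡m; +-distrib-/-∣ʳ)
open import Data.Nat.Divisibility using (divides-refl)
open import Data.Nat.Tactic.RingSolver using (solve-∀)
open import Algebra.Properties.CommutativeSemigroup +-commutativeSemigroup using (interchange; x∙yz≈y∙xz)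
open import Data.Fin using (Fin; _≟_) renaming (zero to fzero; suc to fsuc)
open import Data.Vec using (Vec; []; _∷_; head; tail; sum; tabulate)
open import Data.Vec.Properties using (tabulate-cong; tabulate∘lookup)
open import Data.List using (List; []; _∷_; length; map)
open import Data.List.Relation.Unary.All as All using (All; []; _∷_)
open import Data.List.Relation.Unary.AllPairs using ([]; _∷_)
open import Data.Product using (Σ; ∃₂; _×_; _,_)
open import Data.Empty using (⊥-elim)
open import Relation.Binary.PropositionalEquality
open import Relation.Nullary using (¬_; yes; no)

+-mono-≤-interchange : ∀ a b c d a′ b′ c′ d′ → a + b ≤ a′ + b′ → c + d ≤ c′ + d′ →
  (a + c) + (b + d) ≤ (a′ + c′) + (b′ + d′)
+-mono-≤-interchange a b c d a′ b′ c′ d′ p q =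
  subst₂ _≤_ (interchange a b c d) (interchange a′ b′ c′ d′) (+-mono-≤ p q)

nonzero : ∀ {q} → Fin q → ℕ
nonzero fzero    = 0
nonzero (fsuc _) = 1

nonzero-idem : ∀ {q} (x : Fin q) → nonzero x * nonzero x ≡ nonzero x
nonzero-idem fzero    = refl
nonzero-idem (fsuc _) = refl

weight : ∀ {q n} → Word q n → ℕ
weight []      = 0
weight (x ∷ u) = nonzero x + weight u

common : ∀ {q n} → Word q n → Word q n → ℕ
common []      []      = 0
common (x ∷ u) (y ∷ v) = nonzero x * nonzero y + common u v

-- d(u,v) + |supp u ∩ supp v| ≤ wt u + wt v, checked coordinate by coordinate:
-- a coordinate counted on the left is in the support of u or of v, and a
-- coordinate counted twice on the left is in both supports.
hamming+common≤weights : ∀ {q n} (u v : Word q n) →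
  hamming u v + common u v ≤ weight u + weight v
hamming+common≤weights []      []      = z≤n
hamming+common≤weights (x ∷ u) (y ∷ v) with x ≟ y
... | yes refl = +-mono-≤-interchange 0 (nonzero x * nonzero x) (hamming u v) (common u v)
  (nonzero x) (nonzero x) (weight u) (weight v) (equal x) (hamming+common≤weights u v)
  where
  equal : ∀ {q} (x : Fin q) → 0 + nonzero x * nonzero x ≤ nonzero x + nonzero x
  equal fzero    = z≤n
  equal (fsuc _) = s≤s z≤n
... | no x≢y = +-mono-≤-interchange 1 (nonzero x * nonzero y) (hamming u v) (common u v)
  (nonzero x) (nonzero y) (weight u) (weight v) (distinct x y x≢y) (hamming+common≤weights u v)
  where
  distinct : ∀ {q} (x y : Fin q) → x ≢ y → 1 + nonzero x * nonzero y ≤ nonzero x + nonzero y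
  distinct fzero    fzero    x≢y = ⊥-elim (x≢y refl)
  distinct fzero    (fsuc _) _   = s≤s z≤n
  distinct (fsuc _) fzero    _   = s≤s z≤n
  distinct (fsuc _) (fsuc _) _   = s≤s (s≤s z≤n)

common≤1 : ∀ {q n} W (u v : Word q n) → weight u ≡ W → weight v ≡ W →
  2 * W ∸ 1 ≤ hamming u v → common u v ≤ 1
common≤1 W u v wu wv far = +-cancelˡ-≤ (2 * W ∸ 1) (common u v) 1 (begin
  (2 * W ∸ 1) + common u v     ≤⟨ +-monoˡ-≤ (common u v) far ⟩
  hamming u v + common u v     ≤⟨ hamming+common≤weights u v ⟩
  weight u + weight v          ≡⟨ cong₂ _+_ wu wv ⟩
  W + W                        ≡⟨ cong (W +_) (sym (+-identityʳ W)) ⟩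
  2 * W                        ≤⟨ m≤n+m∸n (2 * W) 1 ⟩
  1 + (2 * W ∸ 1)              ≡⟨ +-comm 1 (2 * W ∸ 1) ⟩
  (2 * W ∸ 1) + 1              ∎)
  where open ≤-Reasoning

indicator : ∀ {q} → Fin q → Fin q → ℕ
indicator a x with a ≟ x
... | yes _ = 1
... | no _  = 0

count-∷ : ∀ {q n} (a x : Fin q) (u : Word q n) → count a (x ∷ u) ≡ indicator a x + count a u
count-∷ a x u with a ≟ x
... | yes _ = refl
... | no _  = refl

indicator-suc : ∀ {q} (a x : Fin q) → indicator (fsuc a) (fsuc x) ≡ indicator a x
indicator-suc a x with a ≟ x
... | yes _ = refl
... | no _  = refl

sum-zeros : ∀ K → sum (tabulate {K} (λ _ → 0)) ≡ 0
sum-zeros zero    = refl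
sum-zeros (suc K) = sum-zeros K

sum-tabulate-+ : ∀ {K} (f g : Fin K → ℕ) →
  sum (tabulate (λ i → f i + g i)) ≡ sum (tabulate f) + sum (tabulate g)
sum-tabulate-+ {zero}  f g = refl
sum-tabulate-+ {suc K} f g =
  trans (cong (f fzero + g fzero +_) (sum-tabulate-+ (λ i → f (fsuc i)) (λ i → g (fsuc i))))
        (interchange (f fzero) (g fzero) _ _)

sum-indicator : ∀ {K} (x : Fin K) → sum (tabulate (λ i → indicator i x)) ≡ 1
sum-indicator {suc K} fzero    = cong (1 +_) (sum-zeros K)
sum-indicator {suc K} (fsuc x) =
  trans (cong sum (tabulate-cong (λ i → indicator-suc i x))) (sum-indicator x)

sum-nonzero-indicators : ∀ {K} (x : Fin (suc K)) →
  sum (tabulate {K} (λ i → indicator (fsuc i) x)) ≡ nonzero x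
sum-nonzero-indicators {K} fzero    = sum-zeros K
sum-nonzero-indicators     (fsuc x) =
  trans (cong sum (tabulate-cong (λ i → indicator-suc i x))) (sum-indicator x)

weight≡sum-counts : ∀ {K n} (u : Word (suc K) n) →
  weight u ≡ sum (tabulate {K} (λ i → count (fsuc i) u))
weight≡sum-counts {K} []      = sym (sum-zeros K)
weight≡sum-counts     (x ∷ u) = sym (begin
  sum (tabulate (λ i → count (fsuc i) (x ∷ u)))
    ≡⟨ cong sum (tabulate-cong (λ i → count-∷ (fsuc i) x u)) ⟩
  sum (tabulate (λ i → indicator (fsuc i) x + count (fsuc i) u))
    ≡⟨ sum-tabulate-+ (λ i → indicator (fsuc i) x) (λ i → count (fsuc i) u) ⟩
  sum (tabulate (λ i → indicator (fsuc i) x)) + sum (tabulate (λ i → count (fsuc i) u))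
    ≡⟨ cong₂ _+_ (sum-nonzero-indicators x) (sym (weight≡sum-counts u)) ⟩
  nonzero x + weight u ∎)
  where open ≡-Reasoning

weight-of-composition : ∀ {K n} (w : Vec ℕ K) (u : Word (suc K) n) →
  HasComposition w u → weight u ≡ sum w
weight-of-composition w u hc =
  trans (weight≡sum-counts u) (cong sum (trans (tabulate-cong hc) (tabulate∘lookup w)))

-- (R - a)(R - a - 1) ≥ 0 for natural numbers R and a, in subtraction-free form.
consecutive-product-bound : ∀ R a → 2 * a * R + R ≤ R * R + a * (a + 1)
consecutive-product-bound R a with R ≤? a
... | yes R≤a = let d , R+d≡a = m≤n⇒∃[o]m+o≡n R≤a in
  subst (λ a → 2 * a * R + R ≤ R * R + a * (a + 1)) R+d≡a (below R d)
  where
  below : ∀ R d → 2 * (R + d) * R + R ≤ R * R + (R + d) * ((R + d) + 1)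
  below R d = subst (2 * (R + d) * R + R ≤_) (gap R d) (m≤m+n _ (d * d + d))
    where
    gap : ∀ R d → (2 * (R + d) * R + R) + (d * d + d) ≡ R * R + (R + d) * ((R + d) + 1)
    gap = solve-∀
... | no R≰a = let d , 1+a+d≡R = m≤n⇒∃[o]m+o≡n (≰⇒> R≰a) in
  subst (λ R → 2 * a * R + R ≤ R * R + a * (a + 1)) 1+a+d≡R (above a d)
  where
  above : ∀ a d → 2 * a * (suc a + d) + (suc a + d) ≤ (suc a + d) * (suc a + d) + a * (a + 1)
  above a d = subst (2 * a * (suc a + d) + (suc a + d) ≤_) (gap a d) (m≤m+n _ (d * d + d))
    where
    gap : ∀ a d → (2 * a * (suc a + d) + (suc a + d)) + (d * d + d)
                ≡ (suc a + d) * (suc a + d) + a * (a + 1)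
    gap = solve-∀

module DoubleCounting {q : ℕ} where

  columnWeight : List (Fin q) → ℕ
  columnWeight []       = 0
  columnWeight (x ∷ xs) = nonzero x + columnWeight xs

  columnPairs : List (Fin q) → ℕ
  columnPairs []       = 0
  columnPairs (x ∷ xs) = nonzero x * columnWeight xs + columnPairs xs

  columnPairs-square : ∀ xs → 2 * columnPairs xs + columnWeight xs ≡ columnWeight xs * columnWeight xs
  columnPairs-square []       = refl
  columnPairs-square (x ∷ xs) = begin
    2 * (c * R + P) + (c + R)         ≡⟨ regroup c R P ⟩
    (2 * P + R) + (2 * (c * R) + c)   ≡⟨ cong₂ _+_ (columnPairs-square xs) (cong (2 * (c * R) +_) (sym (nonzero-idem x))) ⟩
    R * R + (2 * (c * R) + c * c)     ≡⟨ square c R ⟩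
    (c + R) * (c + R)                 ∎
    where
    open ≡-Reasoning
    c = nonzero x
    R = columnWeight xs
    P = columnPairs xs
    regroup : ∀ c R P → 2 * (c * R + P) + (c + R) ≡ (2 * P + R) + (2 * (c * R) + c)
    regroup = solve-∀
    square : ∀ c R → R * R + (2 * (c * R) + c * c) ≡ (c + R) * (c + R)
    square = solve-∀

  column-bound : ∀ xs a → 2 * a * columnWeight xs ≤ 2 * columnPairs xs + a * (a + 1)
  column-bound xs a = +-cancelʳ-≤ R _ _ (begin
    2 * a * R + R              ≤⟨ consecutive-product-bound R a ⟩
    R * R + a * (a + 1)        ≡⟨ cong (_+ a * (a + 1)) (sym (columnPairs-square xs)) ⟩
    2 * P + R + a * (a + 1)    ≡⟨ +-assoc (2 * P) R _ ⟩
    2 * P + (R + a * (a + 1))  ≡⟨ cong (2 * P +_) (+-comm R _) ⟩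
    2 * P + (a * (a + 1) + R)  ≡⟨ +-assoc (2 * P) _ R ⟨
    2 * P + a * (a + 1) + R    ∎)
    where
    open ≤-Reasoning
    R = columnWeight xs
    P = columnPairs xs

  totalWeight : ∀ {n} → List (Word q n) → ℕ
  totalWeight []      = 0
  totalWeight (u ∷ C) = weight u + totalWeight C

  commonWith : ∀ {n} → Word q n → List (Word q n) → ℕ
  commonWith u []      = 0
  commonWith u (v ∷ C) = common u v + commonWith u C

  pairCommon : ∀ {n} → List (Word q n) → ℕ
  pairCommon []      = 0
  pairCommon (u ∷ C) = commonWith u C + pairCommon C

  totalWeight-split : ∀ {n} (C : List (Word q (suc n))) →
    totalWeight C ≡ columnWeight (map head C) + totalWeight (map tail C)
  totalWeight-split []            = refl
  totalWeight-split ((x ∷ u) ∷ C) =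
    trans (cong (nonzero x + weight u +_) (totalWeight-split C))
          (interchange (nonzero x) (weight u) _ _)

  commonWith-split : ∀ {n} x (u : Word q n) (C : List (Word q (suc n))) →
    commonWith (x ∷ u) C ≡ nonzero x * columnWeight (map head C) + commonWith u (map tail C)
  commonWith-split x u []            = cong (_+ 0) (sym (*-zeroʳ (nonzero x)))
  commonWith-split x u ((y ∷ v) ∷ C) = begin
    (nonzero x * nonzero y + common u v) + commonWith (x ∷ u) C
      ≡⟨ cong (nonzero x * nonzero y + common u v +_) (commonWith-split x u C) ⟩
    (nonzero x * nonzero y + common u v) + (nonzero x * columnWeight (map head C) + commonWith u (map tail C))
      ≡⟨ interchange (nonzero x * nonzero y) (common u v) _ _ ⟩
    (nonzero x * nonzero y + nonzero x * columnWeight (map head C)) + (common u v + commonWith u (map tail C))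
      ≡⟨ cong (_+ (common u v + commonWith u (map tail C))) (sym (*-distribˡ-+ (nonzero x) (nonzero y) _)) ⟩
    nonzero x * (nonzero y + columnWeight (map head C)) + (common u v + commonWith u (map tail C))
      ∎
    where open ≡-Reasoning

  pairCommon-split : ∀ {n} (C : List (Word q (suc n))) →
    pairCommon C ≡ columnPairs (map head C) + pairCommon (map tail C)
  pairCommon-split []            = refl
  pairCommon-split ((x ∷ u) ∷ C) =
    trans (cong₂ _+_ (commonWith-split x u C) (pairCommon-split C))
          (interchange (nonzero x * columnWeight (map head C)) _ _ _)

  totalWeight-empty : (C : List (Word q 0)) → totalWeight C ≡ 0
  totalWeight-empty []       = refl
  totalWeight-empty ([] ∷ C) = totalWeight-empty C

  double-counting : ∀ n (C : List (Word q n)) a →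
    2 * a * totalWeight C ≤ 2 * pairCommon C + n * (a * (a + 1))
  double-counting zero    C a = begin
    2 * a * totalWeight C  ≡⟨ cong (2 * a *_) (totalWeight-empty C) ⟩
    2 * a * 0              ≡⟨ *-zeroʳ (2 * a) ⟩
    0                      ≤⟨ z≤n ⟩
    2 * pairCommon C + 0   ∎
    where open ≤-Reasoning
  double-counting (suc n) C a = begin
    2 * a * totalWeight C
      ≡⟨ cong (2 * a *_) (totalWeight-split C) ⟩
    2 * a * (columnWeight (map head C) + totalWeight (map tail C))
      ≡⟨ *-distribˡ-+ (2 * a) _ _ ⟩
    2 * a * columnWeight (map head C) + 2 * a * totalWeight (map tail C)
      ≤⟨ +-mono-≤ (column-bound (map head C) a) (double-counting n (map tail C) a) ⟩
    (2 * P₁ + b) + (2 * P + n * b)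
      ≡⟨ regroup P₁ P b n ⟩
    2 * (P₁ + P) + (b + n * b)
      ≡⟨ cong (λ p → 2 * p + suc n * b) (pairCommon-split C) ⟨
    2 * pairCommon C + suc n * b
      ∎
    where
    open ≤-Reasoning
    b = a * (a + 1)
    P₁ = columnPairs (map head C)
    P = pairCommon (map tail C)
    regroup : ∀ P₁ P b n → (2 * P₁ + b) + (2 * P + n * b) ≡ 2 * (P₁ + P) + (b + n * b)
    regroup = solve-∀

  totalWeight-constant : ∀ {n} W (C : List (Word q n)) → All (λ u → weight u ≡ W) C →
    totalWeight C ≡ length C * W
  totalWeight-constant W []      []         = refl
  totalWeight-constant W (u ∷ C) (wu ∷ wC) = cong₂ _+_ wu (totalWeight-constant W C wC)

  -- In a code of constant weight W and minimum distance 2W - 1, any two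
  -- codewords share at most one nonzero coordinate, so the pair sum is at
  -- most C(|C|,2).
  commonWith-bound : ∀ {n} W (u : Word q n) (C : List (Word q n)) → weight u ≡ W →
    All (λ v → weight v ≡ W) C → All (λ v → (u ≢ v) × (2 * W ∸ 1 ≤ hamming u v)) C →
    commonWith u C ≤ length C
  commonWith-bound W u []      wu []         []              = z≤n
  commonWith-bound W u (v ∷ C) wu (wv ∷ wC) ((_ , far) ∷ fC) =
    +-mono-≤ (common≤1 W u v wu wv far) (commonWith-bound W u C wu wC fC)

  pairCommon-bound : ∀ {n} W (C : List (Word q n)) → All (λ v → weight v ≡ W) C →
    IsCode (2 * W ∸ 1) C → 2 * pairCommon C + length C ≤ length C * length C
  pairCommon-bound W []      []         []         = z≤n
  pairCommon-bound W (u ∷ C) (wu ∷ wC) (fu ∷ fC) = +-cancelʳ-≤ m _ _ (begin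
    (2 * (c + P) + suc m) + m   ≡⟨ regroup c P m ⟩
    (2 * P + m) + (2 * c + suc m)
      ≤⟨ +-mono-≤ (pairCommon-bound W C wC fC) (+-monoˡ-≤ (suc m) (*-monoʳ-≤ 2 (commonWith-bound W u C wu wC fu))) ⟩
    m * m + (2 * m + suc m)     ≡⟨ square m ⟩
    suc m * suc m + m           ∎)
    where
    open ≤-Reasoning
    m = length C
    c = commonWith u C
    P = pairCommon C
    regroup : ∀ c P m → (2 * (c + P) + suc m) + m ≡ (2 * P + m) + (2 * c + suc m)
    regroup = solve-∀
    square : ∀ m → m * m + (2 * m + suc m) ≡ suc m * suc m + m
    square = solve-∀

open DoubleCounting using (totalWeight; pairCommon; double-counting; totalWeight-constant; pairCommon-bound)

code-size-bound : ∀ {q n} W (C : List (Word q n)) a → All (λ u → weight u ≡ W) C →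
  IsCode (2 * W ∸ 1) C → 2 * a * (length C * W) + length C ≤ length C * length C + n * (a * (a + 1))
code-size-bound {n = n} W C a wC code = begin
  2 * a * (length C * W) + length C        ≡⟨ cong (λ t → 2 * a * t + length C) (totalWeight-constant W C wC) ⟨
  2 * a * totalWeight C + length C         ≤⟨ +-monoˡ-≤ (length C) (double-counting n C a) ⟩
  2 * pairCommon C + b + length C          ≡⟨ +-assoc (2 * pairCommon C) b (length C) ⟩
  2 * pairCommon C + (b + length C)        ≡⟨ cong (2 * pairCommon C +_) (+-comm b (length C)) ⟩
  2 * pairCommon C + (length C + b)        ≡⟨ +-assoc (2 * pairCommon C) (length C) b ⟨
  2 * pairCommon C + length C + b          ≤⟨ +-monoˡ-≤ b (pairCommon-bound W C wC code) ⟩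
  length C * length C + b                  ∎
  where
  open ≤-Reasoning
  b = n * (a * (a + 1))

floor-unique : ∀ q r d → r ≤ d → (r + q * suc d) / suc d ≡ q
floor-unique q r d r≤d = trans (+-distrib-/-∣ʳ r (divides-refl q))
  (cong₂ _+_ (m<n⇒m/n≡0 (s≤s r≤d)) (m*n/n≡m q (suc d)))

ceiling-unique : ∀ a t q d → a + t ≡ q * suc d → t ≤ d → cdiv a (suc d) ≡ q
ceiling-unique a t q d a+t≡qd t≤d = trans (cong (_/ suc d) shift) (floor-unique q (d ∸ t) d (m∸n≤m d t))
  where
  open ≡-Reasoning
  shift : a + d ≡ (d ∸ t) + q * suc d
  shift = begin
    a + d              ≡⟨ cong (a +_) (m∸n+n≡m t≤d) ⟨
    a + ((d ∸ t) + t)  ≡⟨ x∙yz≈y∙xz a (d ∸ t) t ⟩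
    (d ∸ t) + (a + t)  ≡⟨ cong ((d ∸ t) +_) a+t≡qd ⟩
    (d ∸ t) + q * suc d ∎

ceiling-decomposition : ∀ W p → ∃₂ λ s r → p ≡ s + r × cdiv W (suc p) * suc p ≡ W + s
ceiling-decomposition W p = p ∸ ρ , ρ , sym (m∸n+n≡m ρ≤p) , +-cancelʳ-≡ ρ _ _ (begin
  L * suc p + ρ        ≡⟨ +-comm (L * suc p) ρ ⟩
  ρ + L * suc p        ≡⟨ m≡m%n+[m/n]*n (W + p) (suc p) ⟨
  W + p                ≡⟨ cong (W +_) (m∸n+n≡m ρ≤p) ⟨
  W + (p ∸ ρ + ρ)      ≡⟨ +-assoc W (p ∸ ρ) ρ ⟨
  W + (p ∸ ρ) + ρ      ∎)
  where
  open ≡-Reasoning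
  L = (W + p) / suc p
  ρ = (W + p) % suc p
  ρ≤p : ρ ≤ p
  ρ≤p = ≤-pred (m%n<n (W + p) (suc p))

halve-division : ∀ s l → Σ ℕ λ f → Σ ℕ λ g → Σ ℕ λ e →
  s ≡ f + g × 2 * g ≡ f * l + e × e < 2 + l
halve-division s l = f , s ∸ f , e , sym (m+[n∸m]≡n f≤s) , twice-g , m%n<n (2 * s) (2 + l)
  where
  f = (2 * s) / (2 + l)
  e = (2 * s) % (2 + l)
  2s≡ : 2 * s ≡ e + f * (2 + l)
  2s≡ = m≡m%n+[m/n]*n (2 * s) (2 + l)
  f≤s : f ≤ s
  f≤s = *-cancelˡ-≤ 2 (begin
    2 * f            ≡⟨ *-comm 2 f ⟩
    f * 2            ≤⟨ *-monoʳ-≤ f (s≤s (s≤s (z≤n {l}))) ⟩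
    f * (2 + l)      ≤⟨ m≤n+m (f * (2 + l)) e ⟩
    e + f * (2 + l)  ≡⟨ 2s≡ ⟨
    2 * s            ∎)
    where open ≤-Reasoning
  twice-g : 2 * (s ∸ f) ≡ f * l + e
  twice-g = +-cancelˡ-≡ (2 * f) _ _ (begin
    2 * f + 2 * (s ∸ f)   ≡⟨ *-distribˡ-+ 2 f (s ∸ f) ⟨
    2 * (f + (s ∸ f))     ≡⟨ cong (2 *_) (m+[n∸m]≡n f≤s) ⟩
    2 * s                 ≡⟨ 2s≡ ⟩
    e + f * (2 + l)       ≡⟨ regroup f l e ⟩
    2 * f + (f * l + e)   ∎)
    where
    open ≡-Reasoning
    regroup : ∀ f l e → e + f * (2 + l) ≡ 2 * f + (f * l + e)
    regroup = solve-∀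

-- With λ = 2 + l, s = f + g and h = 1 + s + r, the quantities λh - 2s,
-- μ = (λ - 1)(λh - 2s) and w = λh - s become the following polynomials.
λh∸2s : ℕ → ℕ → ℕ → ℕ → ℕ
λh∸2s l f g r = l * (f + g) + (2 + l) * (1 + r)

μ-poly : ℕ → ℕ → ℕ → ℕ → ℕ
μ-poly l f g r = (1 + l) * λh∸2s l f g r

w-poly : ℕ → ℕ → ℕ → ℕ → ℕ
w-poly l f g r = (1 + l) * (f + g) + (2 + l) * (1 + r)

λh≡w+s : ∀ l f g r → (2 + l) * suc (f + g + r) ≡ w-poly l f g r + (f + g)
λh≡w+s = expanded
  where
  expanded : ∀ l f g r → (2 + l) * suc (f + g + r) ≡ ((1 + l) * (f + g) + (2 + l) * (1 + r)) + (f + g)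
  expanded = solve-∀

-- The description of h = w₁ and W = w through λ = 2 + l, s = f + g,
-- h = 1 + s + r and 2s = fλ + e with e < λ (so that f = ⌊2s/λ⌋).
record ParameterSplit (h W : ℕ) : Set where
  field
    l f g r e : ℕ
    head≡   : h ≡ suc (f + g + r)
    lam≡    : cdiv W h ≡ 2 + l
    weight≡ : W ≡ w-poly l f g r
    twice-g : 2 * g ≡ f * l + e
    e<λ     : e < 2 + l

ceiling≥2 : ∀ W p → suc p < W → 2 ≤ cdiv W (suc p)
ceiling≥2 W p h<W with ceiling-decomposition W p
... | s , _ , _ , Lh≡W+s = *-cancelʳ-< (suc p) 1 (cdiv W (suc p)) (begin-strict
  1 * suc p                ≡⟨ *-identityˡ (suc p) ⟩
  suc p                    <⟨ h<W ⟩
  W                        ≤⟨ m≤m+n W s ⟩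
  W + s                    ≡⟨ Lh≡W+s ⟨
  cdiv W (suc p) * suc p   ∎)
  where open ≤-Reasoning

splitParameters : ∀ p W → suc p < W → ParameterSplit (suc p) W
splitParameters p W h<W with ceiling-decomposition W p
... | s , r , p≡s+r , Lh≡W+s with m≤n⇒∃[o]m+o≡n (ceiling≥2 W p h<W)
...   | l , 2+l≡L with halve-division s l
...     | f , g , e , s≡f+g , twice-g , e<λ = record
  { l = l ; f = f ; g = g ; r = r ; e = e
  ; head≡ = cong suc (trans p≡s+r (cong (_+ r) s≡f+g))
  ; lam≡ = sym 2+l≡L
  ; weight≡ = +-cancelʳ-≡ s _ _ (begin
      W + s                               ≡⟨ Lh≡W+s ⟨
      L * suc p                           ≡⟨ cong₂ _*_ (sym 2+l≡L) (cong suc (trans p≡s+r (cong (_+ r) s≡f+g))) ⟩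
      (2 + l) * suc (f + g + r)           ≡⟨ λh≡w+s l f g r ⟩
      w-poly l f g r + (f + g)            ≡⟨ cong (w-poly l f g r +_) s≡f+g ⟨
      w-poly l f g r + s                  ∎)
  ; twice-g = twice-g
  ; e<λ = e<λ }
  where
  open ≡-Reasoning
  L = cdiv W (suc p)

-- λh - 2s + e = λ(1 + r + g), i.e. λh - 2s = λ⌈(λh - 2s)/λ⌉ - e.
λh∸2s+e : ∀ l f g r e → 2 * g ≡ f * l + e → λh∸2s l f g r + e ≡ (2 + l) * (1 + r + g)
λh∸2s+e l f g r e twice-g = +-cancelˡ-≡ (f * l) _ _ (begin
  f * l + (P + e)                  ≡⟨ x∙yz≈y∙xz (f * l) P e ⟩
  P + (f * l + e)                  ≡⟨ cong (P +_) twice-g ⟨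
  P + 2 * g                        ≡⟨ regroup l f g r ⟩
  f * l + (2 + l) * (1 + r + g)    ∎)
  where
  open ≡-Reasoning
  P = λh∸2s l f g r
  regroup : ∀ l f g r → (l * (f + g) + (2 + l) * (1 + r)) + 2 * g ≡ f * l + (2 + l) * (1 + r + g)
  regroup = solve-∀

-- μ words of weight w at length μh + g + r violate code-size-bound with
-- a = λ - 1 = 1 + l.  Writing P = λh - 2s (so μ = aP) and X = λ(g + r), the
-- two sides differ by a(P - X) > 0.
size-bound-violated : ∀ l f g r e → 2 * g ≡ f * l + e → e < 2 + l →
  μ-poly l f g r * μ-poly l f g r + (μ-poly l f g r * suc (f + g + r) + (g + r)) * ((1 + l) * ((1 + l) + 1))
    < 2 * (1 + l) * (μ-poly l f g r * w-poly l f g r) + μ-poly l f g r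
size-bound-violated l f g r e twice-g e<λ = +-cancelʳ-< (a * P) _ _ (begin-strict
  E₂ + a * P   ≡⟨ balance l f g r ⟨
  E₁ + a * X   <⟨ +-monoʳ-< E₁ (*-monoʳ-< a X<P) ⟩
  E₁ + a * P   ∎)
  where
  open ≤-Reasoning
  a = 1 + l
  P = λh∸2s l f g r
  M = μ-poly l f g r
  X = (2 + l) * (g + r)
  E₁ = 2 * a * (M * w-poly l f g r) + M
  E₂ = M * M + (M * suc (f + g + r) + (g + r)) * (a * (a + 1))
  X<P : X < P
  X<P = +-cancelʳ-≤ e (suc X) P (begin
    suc X + e              ≡⟨ +-suc X e ⟨
    X + suc e              ≤⟨ +-monoʳ-≤ X e<λ ⟩
    X + (2 + l)            ≡⟨ regroup l g r ⟩
    (2 + l) * (1 + r + g)  ≡⟨ λh∸2s+e l f g r e twice-g ⟨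
    P + e                  ∎)
    where
    regroup : ∀ l g r → (2 + l) * (g + r) + (2 + l) ≡ (2 + l) * (1 + r + g)
    regroup = solve-∀
  balance : ∀ l f g r →
    let a = 1 + l
        P = l * (f + g) + (2 + l) * (1 + r)
        M = a * P
    in 2 * a * (M * (a * (f + g) + (2 + l) * (1 + r))) + M + a * ((2 + l) * (g + r))
       ≡ M * M + (M * suc (f + g + r) + (g + r)) * (a * (a + 1)) + a * P
  balance = solve-∀

-- Everything in Proposition 6, computed from a ParameterSplit of h = w₁ and
-- W = w.  Here N = μh + g + r is one less than the claimed bound.
module SplitConsequences {k} (w : Vec ℕ (suc k)) (S : ParameterSplit (head w) (sum w)) where
  open ParameterSplit S
  open ≡-Reasoning

  M : ℕ
  M = μ-poly l f g r

  h′ : ℕ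
  h′ = suc (f + g + r)

  N : ℕ
  N = M * head w + (g + r)

  Bound : ℕ
  Bound = mu w * head w + cdiv (mu w) (lam w * (lam w ∸ 1))

  sPar≡ : sPar w ≡ f + g
  sPar≡ = begin
    lam w * head w ∸ sum w                        ≡⟨ cong₂ _∸_ (cong₂ _*_ lam≡ head≡) weight≡ ⟩
    (2 + l) * h′ ∸ w-poly l f g r                 ≡⟨ cong (_∸ w-poly l f g r) (λh≡w+s l f g r) ⟩
    w-poly l f g r + (f + g) ∸ w-poly l f g r     ≡⟨ m+n∸m≡n (w-poly l f g r) (f + g) ⟩
    f + g                                         ∎

  mu≡ : mu w ≡ M
  mu≡ = begin
    lam w * (lam w ∸ 1) * head w ∸ 2 * (lam w ∸ 1) * sPar w
      ≡⟨ cong (λ s → lam w * (lam w ∸ 1) * head w ∸ 2 * (lam w ∸ 1) * s) sPar≡ ⟩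
    lam w * (lam w ∸ 1) * head w ∸ 2 * (lam w ∸ 1) * (f + g)
      ≡⟨ cong₂ (λ L h → L * (L ∸ 1) * h ∸ 2 * (L ∸ 1) * (f + g)) lam≡ head≡ ⟩
    (2 + l) * (1 + l) * h′ ∸ 2 * (1 + l) * (f + g)
      ≡⟨ cong (_∸ 2 * (1 + l) * (f + g)) (expand l f g r) ⟩
    M + 2 * (1 + l) * (f + g) ∸ 2 * (1 + l) * (f + g)
      ≡⟨ m+n∸n≡m M (2 * (1 + l) * (f + g)) ⟩
    M ∎
    where
    expand : ∀ l f g r → (2 + l) * (1 + l) * suc (f + g + r)
                         ≡ (1 + l) * (l * (f + g) + (2 + l) * (1 + r)) + 2 * (1 + l) * (f + g)
    expand = solve-∀

  -- ⌈μ/λ(λ-1)⌉ = ⌈(λh - 2s)/λ⌉ = 1 + g + r.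
  ceiling≡ : cdiv (mu w) (lam w * (lam w ∸ 1)) ≡ 1 + g + r
  ceiling≡ = trans (cong₂ (λ m L → cdiv m (L * (L ∸ 1))) mu≡ lam≡)
    (ceiling-unique M ((1 + l) * e) (1 + g + r) (l + (1 + l) * (1 + l)) M+ae≡ ae≤)
    where
    M+ae≡ : M + (1 + l) * e ≡ (1 + g + r) * ((2 + l) * (1 + l))
    M+ae≡ = begin
      (1 + l) * λh∸2s l f g r + (1 + l) * e   ≡⟨ *-distribˡ-+ (1 + l) (λh∸2s l f g r) e ⟨
      (1 + l) * (λh∸2s l f g r + e)          ≡⟨ cong ((1 + l) *_) (λh∸2s+e l f g r e twice-g) ⟩
      (1 + l) * ((2 + l) * (1 + r + g))      ≡⟨ regroup l g r ⟩
      (1 + g + r) * ((2 + l) * (1 + l))      ∎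
      where
      regroup : ∀ l g r → (1 + l) * ((2 + l) * (1 + r + g)) ≡ (1 + g + r) * ((2 + l) * (1 + l))
      regroup = solve-∀
    ae≤ : (1 + l) * e ≤ l + (1 + l) * (1 + l)
    ae≤ = ≤-trans (*-monoʳ-≤ (1 + l) (≤-pred e<λ)) (m≤n+m ((1 + l) * (1 + l)) l)

  floor≡ : fdiv (2 * sPar w) (lam w) ≡ f
  floor≡ = trans (cong₂ (λ s L → fdiv (2 * s) L) sPar≡ lam≡)
    (trans (cong (_/ (2 + l)) 2s≡) (floor-unique f e (1 + l) (≤-pred e<λ)))
    where
    2s≡ : 2 * (f + g) ≡ e + f * (2 + l)
    2s≡ = begin
      2 * (f + g)          ≡⟨ *-distribˡ-+ 2 f g ⟩
      2 * f + 2 * g        ≡⟨ cong (2 * f +_) twice-g ⟩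
      2 * f + (f * l + e)  ≡⟨ regroup f l e ⟩
      e + f * (2 + l)      ∎
      where
      regroup : ∀ f l e → 2 * f + (f * l + e) ≡ e + f * (2 + l)
      regroup = solve-∀

  Bound≡ : Bound ≡ M * h′ + (1 + g + r)
  Bound≡ = cong₂ _+_ (cong₂ _*_ mu≡ head≡) ceiling≡

  closed-form : Bound ≡ (mu w + 1) * head w ∸ fdiv (2 * sPar w) (lam w)
  closed-form = begin
    Bound                                           ≡⟨ Bound≡ ⟩
    M * h′ + (1 + g + r)                            ≡⟨ m+n∸n≡m (M * h′ + (1 + g + r)) f ⟨
    M * h′ + (1 + g + r) + f ∸ f                    ≡⟨ cong (_∸ f) (regroup M f g r) ⟩
    (M + 1) * h′ ∸ f                                ≡⟨ cong₂ (λ m h → (m + 1) * h ∸ f) mu≡ head≡ ⟨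
    (mu w + 1) * head w ∸ f                         ≡⟨ cong ((mu w + 1) * head w ∸_) floor≡ ⟨
    (mu w + 1) * head w ∸ fdiv (2 * sPar w) (lam w) ∎
    where
    regroup : ∀ M f g r → M * suc (f + g + r) + (1 + g + r) + f ≡ (M + 1) * suc (f + g + r)
    regroup = solve-∀

  -- ⌊N/h⌋ = μ: this is the size A_q(N, 2w-1, w̄) would have if N were admissible.
  floorN≡ : fdiv N (head w) ≡ M
  floorN≡ = begin
    fdiv N (head w)               ≡⟨ cong₂ (λ h h₁ → fdiv (M * h + (g + r)) h₁) head≡ head≡ ⟩
    (M * h′ + (g + r)) / h′       ≡⟨ cong (_/ h′) (+-comm (M * h′) (g + r)) ⟩
    ((g + r) + M * h′) / h′       ≡⟨ floor-unique M (g + r) (f + g + r) g+r≤ ⟩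
    M                             ∎
    where
    g+r≤ : g + r ≤ f + g + r
    g+r≤ = subst (g + r ≤_) (sym (+-assoc f g r)) (m≤n+m (g + r) f)

  no-code-of-size-μ : ¬ AEq N (2 * sum w ∸ 1) w (fdiv N (head w))
  no-code-of-size-μ ((C , (code , compositions) , |C|≡) , _) =
    violates (trans |C|≡ floorN≡) weight≡ head≡
      (code-size-bound (sum w) C (1 + l) (All.map (λ {u} → weight-of-composition w u) compositions) code)
    where
    violates : ∀ {m W h} → m ≡ M → W ≡ w-poly l f g r → h ≡ h′ →
      ¬ (2 * (1 + l) * (m * W) + m ≤ m * m + (M * h + (g + r)) * ((1 + l) * ((1 + l) + 1)))
    violates refl refl refl = <⇒≱ (size-bound-violated l f g r e twice-g e<λ)

  Bound≡suc-N : Bound ≡ suc N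
  Bound≡suc-N = trans Bound≡ (trans (cong (λ h → M * h + suc (g + r)) (sym head≡)) (+-suc (M * head w) (g + r)))

  lower-bound : NcccAtLeast w Bound
  lower-bound n₀ admissible with suc N ≤? n₀
  ... | yes N<n₀ = subst (_≤ n₀) (sym Bound≡suc-N) N<n₀
  ... | no N≮n₀  = ⊥-elim (no-code-of-size-μ (admissible N (≤-pred (≰⇒> N≮n₀))))

-- Proposition 6.  The first two components of a composition are positive
-- (the pattern below covers all compositions), so w₁ < w and the parameters
-- split as in ParameterSplit.
proposition6 : (k : ℕ) (w : Vec ℕ (suc (suc k))) → IsComposition w →
    (mu w * head w + cdiv (mu w) (lam w * (lam w ∸ 1))
      ≡ (mu w + 1) * head w ∸ fdiv (2 * sPar w) (lam w))
    × NcccAtLeast w (mu w * head w + cdiv (mu w) (lam w * (lam w ∸ 1)))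
proposition6 k w@(suc p ∷ suc q ∷ ws) _ = closed-form , lower-bound
  where
  w₁<w : suc p < sum w
  w₁<w = m<m+n (suc p) (s≤s z≤n)
  open SplitConsequences w (splitParameters p (sum w) w₁<w)
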